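{- Let $\mathcal{B}$ be a smooth barrier and $X$ a final segment of $\operatorname{base}(\mathcal{B})$. Then $\operatorname{ht}(\mathcal{B})=\operatorname{ht}(\mathcal{B}\restriction X)$, where $\mathcal{B}\restriction X=\{s\in\mathcal{B}:s\subseteq X\}$.
   Context: Finite subsets of $\mathbb{N}$ are identified with strictly increasing sequences; $\sqsubset$ is proper initial segment. A set $\mathcal{B}\subseteq[\mathbb{N}]^{<\omega}$ is a front if either $\mathcal{B}=\{\langle\rangle\}$ (base $\mathbb{N}$ by convention) or: (1) $\operatorname{base}(\mathcal{B})=\bigcup\mathcal{B}$ infinite; (2) every infinite $X\subseteq\operatorname{base}(\mathcal{B})$ has $s\in\mathcal{B}$ with $s\sqsubset X$; (3) no $s,t\in\mathcal{B}$ with $s\sqsubset t$. Barrier: front with no $s\subsetneq t$ in it. Smooth: for $s,t\in\mathcal{B}$ with $|s|<|t|$ some $i<|s|$ has $s(i)<t(i)$. $X$ is a final segment of $Y$ if $X=\{n\in Y:n\ge m\}$ for some $m$. $T(\mathcal{B})$: finite subsets of $\operatorname{base}(\mathcal{B})$ with no proper initial segment in $\mathcal{B}$; $\operatorname{ht}_{\mathcal{B}}(s)=0$ on $\mathcal{B}$, else $\sup\{\operatorname{ht}_{\mathcal{B}}(s^\frown\langle n\rangle)+1: s^\frown\langle n\rangle\in T(\mathcal{B})\}$; $\operatorname{ht}(\mathcal{B})=\operatorname{ht}_{\mathcal{B}}(\langle\rangle)$. -}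

module Defs where

open import Level using (Level; suc) renaming (zero to lzero)
open import Data.Nat using (ℕ; _≤_; _<_)
open import Data.Fin as Fin using (Fin)
open import Data.List using (List; []; _∷_; _++_; [_]; length; lookup)
open import Data.List.Relation.Unary.All using (All)
open import Data.List.Relation.Unary.Linked using (Linked)
open import Data.List.Membership.Propositional using (_∈_)
open import Data.Nat.Properties using (<⇒≤)
open import Data.Product using (Σ; ∃; _×_; _,_; proj₁)
open import Data.Sum using (_⊎_)
open import Data.Unit using (⊤)
open import Data.Empty using (⊥)
open import Relation.Nullary using (¬_)
open import Relation.Binary.PropositionalEquality using (_≡_; _≢_)

-- Finite subsets of ℕ = strictly increasing lists.
-- A family of finite sets = a predicate on lists.

Increasing : List ℕ → Set
Increasing = Linked _<_

Family : Set₁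
Family = List ℕ → Set

_⊏_ : List ℕ → List ℕ → Set
u ⊏ s = Σ ℕ λ k → Σ (List ℕ) λ v → u ++ (k ∷ v) ≡ s

_⊆ˡ_ : List ℕ → List ℕ → Set
s ⊆ˡ t = All (_∈ t) s

_⊊ˡ_ : List ℕ → List ℕ → Set
s ⊊ˡ t = s ⊆ˡ t × s ≢ t

Infinite : (ℕ → Set) → Set
Infinite X = (m : ℕ) → Σ ℕ λ n → m ≤ n × X n

-- s ⊏ X for an infinite set X: s is increasing, s ⊆ X, and every element
-- of X below some element of s belongs to s (so s = first |s| elements of X)
InitSegOf : List ℕ → (ℕ → Set) → Set
InitSegOf s X = Increasing s × All X s ×
  ((n : ℕ) → X n → (Σ ℕ λ k → k ∈ s × n ≤ k) → n ∈ s)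

IsTrivial : Family → Set
IsTrivial B = ((s : List ℕ) → B s → s ≡ []) × B []

-- base(B) = ⋃B, and base({⟨⟩}) = ℕ by convention
Base : Family → ℕ → Set
Base B n = IsTrivial B ⊎ (Σ (List ℕ) λ s → B s × n ∈ s)

IsFront : Family → Set₁
IsFront B =
  ((s : List ℕ) → B s → Increasing s) ×
  (IsTrivial B ⊎
    ( Infinite (λ n → Σ (List ℕ) λ s → B s × n ∈ s)
    × ((X : ℕ → Set) → Infinite X → ((n : ℕ) → X n → Base B n) →
         Σ (List ℕ) λ s → B s × InitSegOf s X)
    × ((s t : List ℕ) → B s → B t → ¬ (s ⊏ t))))

IsBarrier : Family → Set₁
IsBarrier B = IsFront B × ((s t : List ℕ) → B s → B t → ¬ (s ⊊ˡ t))

IsSmooth : Family → Set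
IsSmooth B = (s t : List ℕ) → B s → B t → (lt : length s < length t) →
  Σ (Fin (length s)) λ i →
    lookup s i < lookup t (Fin.inject≤ i (<⇒≤ lt))

FinalSeg : Family → ℕ → ℕ → Set
FinalSeg B m n = Base B n × m ≤ n

Restrict : Family → (ℕ → Set) → Family
Restrict B X s = B s × All X s

T : Family → List ℕ → Set
T B s = Increasing s × All (Base B) s × ((u : List ℕ) → u ⊏ s → ¬ B u)

Child : Family → List ℕ → Set
Child B s = Σ ℕ λ n → T B (s ++ [ n ])

-- Ordinals: Brouwer trees with sups over arbitrary index types,
-- compared via their classical ordinal interpretation.

data Ord : Set₁ where
  ozero : Ord
  osuc  : Ord → Ord
  osup  : (I : Set) → (I → Ord) → Ord

mutual
  _≤o_ : Ord → Ord → Set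
  ozero    ≤o β = ⊤
  osuc α   ≤o β = α <o β
  osup I f ≤o β = (i : I) → f i ≤o β

  _<o_ : Ord → Ord → Set
  α <o ozero    = ⊥
  α <o osuc β   = α ≤o β
  α <o osup I f = Σ I λ i → α <o f i

_≈o_ : Ord → Ord → Set
α ≈o β = α ≤o β × β ≤o α

data Ht (B : Family) : List ℕ → Ord → Set₁ where
  leaf : {s : List ℕ} → T B s → B s → Ht B s ozero
  node : {s : List ℕ} → T B s → ¬ B s →
         (h : Child B s → Ord) →
         ((c : Child B s) → Ht B (s ++ [ proj₁ c ]) (h c)) →
         Ht B s (osup (Child B s) (λ c → osuc (h c)))

{-# OPTIONS --safe #-}
module Submission where

-- A simulation of T(B₁) in T(B₂) (a relation under which B₂-leaves pull back to B₁-leaves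
-- and children lift to related children) gives ht_{B₁} ≤ ht_{B₂}.  Since base(B↾X) = X,
-- T(B↾X) ⊆ T(B), and the identity simulates T(B↾X) in T(B).  Conversely, relate s ∈ T(B)
-- to s' ∈ T(B↾X) when s ≤ s' pointwise.  Children lift because X is cofinal in base(B).
-- A leaf s' ∈ B↾X pulls back to s ∈ B: otherwise, B being a front, s ⊏ t for some t ∈ B,
-- and smoothness would give i < |s'| with s'(i) < t(i) = s(i) ≤ s'(i).

open import Defs
open import Data.Nat using (ℕ; suc; _≤_; _<_; _⊔_; s≤s; z≤n)
open import Data.Nat.Properties using (≤-refl; ≤-trans; <⇒≤; <⇒≱; <-trans; ≤-total; ≤-antisym; m⊔n≤o⇒m≤o; m⊔n≤o⇒n≤o)
open import Data.List using (List; []; _∷_; _++_; [_]; length; lookup)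
open import Data.List.Properties using (∷-injective)
open import Data.List.Relation.Unary.All as All using (All; []; _∷_)
open import Data.List.Relation.Unary.All.Properties using (++⁺; ++⁻ˡ)
open import Data.List.Relation.Unary.Any using (here; there)
open import Data.List.Relation.Unary.Linked as Linked using ([]; [-]; _∷_)
open import Data.List.Relation.Binary.Pointwise as Pointwise using (Pointwise; []; _∷_)
open import Data.List.Membership.Propositional using (_∈_)
open import Data.Fin as Fin using (Fin)
open import Data.Product using (Σ; _×_; _,_; proj₁; proj₂)
open import Data.Sum as Sum using (_⊎_; inj₁; inj₂; [_,_]′)
open import Data.Unit using (tt)
open import Data.Empty using (⊥-elim)
open import Function using (id; _∘_)
open import Relation.Nullary using (¬_)
open import Relation.Binary.PropositionalEquality using (_≡_; refl; cong)

Union : Family → ℕ → Set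
Union B n = Σ (List ℕ) λ s → B s × n ∈ s

head<tail : ∀ {a s} → Increasing (a ∷ s) → All (a <_) s
head<tail [-] = []
head<tail (a<b ∷ inc) = a<b ∷ All.map (<-trans a<b) (head<tail inc)

head≤∈ : ∀ {a s n} → Increasing (a ∷ s) → n ∈ a ∷ s → a ≤ n
head≤∈ inc (here refl) = ≤-refl
head≤∈ inc (there n∈s) = <⇒≤ (All.lookup (head<tail inc) n∈s)

Increasing-snoc : ∀ {s n} → Increasing s → All (_< n) s → Increasing (s ++ [ n ])
Increasing-snoc [] [] = [-]
Increasing-snoc [-] (a<n ∷ []) = a<n ∷ [-]
Increasing-snoc (a<b ∷ inc) (_ ∷ s<n) = a<b ∷ Increasing-snoc inc s<n

Infinite-above : ∀ {P} → Infinite P → (q : ℕ) (s : List ℕ) →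
  Σ ℕ λ n → q ≤ n × All (_< n) s × P n
Infinite-above P∞ q [] = let n , q≤n , Pn = P∞ q in n , q≤n , [] , Pn
Infinite-above P∞ q (a ∷ s) =
  let n , q⊔a<n , s<n , Pn = Infinite-above P∞ (q ⊔ suc a) s
  in n , m⊔n≤o⇒m≤o q _ q⊔a<n , m⊔n≤o⇒n≤o q _ q⊔a<n ∷ s<n , Pn

∷-⊏ : ∀ {a s t} → s ⊏ t → (a ∷ s) ⊏ (a ∷ t)
∷-⊏ (k , v , s++k∷v≡t) = k , v , cong (_ ∷_) s++k∷v≡t

⊏-snoc⁻ : ∀ {u} s {n} → u ⊏ (s ++ [ n ]) → u ≡ s ⊎ u ⊏ s
⊏-snoc⁻ {[]} [] _ = inj₁ refl
⊏-snoc⁻ {[]} (a ∷ s) _ = inj₂ (a , s , refl)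
⊏-snoc⁻ {_ ∷ []} [] (_ , _ , ())
⊏-snoc⁻ {_ ∷ _ ∷ _} [] (_ , _ , ())
⊏-snoc⁻ {a ∷ u} (b ∷ s) (k , v , a∷u++k∷v≡b∷s++n)
  with ∷-injective a∷u++k∷v≡b∷s++n
... | refl , u++k∷v≡s++n = Sum.map (cong (a ∷_)) ∷-⊏ (⊏-snoc⁻ s (k , v , u++k∷v≡s++n))

All-⊏ : ∀ {P : ℕ → Set} {u s} → All P s → u ⊏ s → All P u
All-⊏ {u = u} Ps (_ , _ , refl) = ++⁻ˡ u Ps

⊏-length< : ∀ {R : ℕ → ℕ → Set} {s s' t} → Pointwise R s s' → s ⊏ t → length s' < length t
⊏-length< [] (_ , _ , refl) = s≤s z≤n
⊏-length< (_ ∷ rs) (k , v , refl) = s≤s (⊏-length< rs (k , v , refl))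

⊏-lookup-≤ : ∀ {s s' t} → Pointwise _≤_ s s' → s ⊏ t →
  (i : Fin (length s')) (p : length s' ≤ length t) → lookup t (Fin.inject≤ i p) ≤ lookup s' i
⊏-lookup-≤ (x≤y ∷ _) (_ , _ , refl) Fin.zero _ = x≤y
⊏-lookup-≤ (_ ∷ s≤s') (k , v , refl) (Fin.suc i) (s≤s p) = ⊏-lookup-≤ s≤s' (k , v , refl) i p

smooth-¬⊏ : ∀ {B s s' t} → IsSmooth B → B s' → B t → Pointwise _≤_ s s' → ¬ s ⊏ t
smooth-¬⊏ smooth bs' bt s≤s' s⊏t =
  let |s'|<|t| = ⊏-length< s≤s' s⊏t
      i , s'ᵢ<tᵢ = smooth _ _ bs' bt |s'|<|t|
  in <⇒≱ s'ᵢ<tᵢ (⊏-lookup-≤ s≤s' s⊏t i (<⇒≤ |s'|<|t|))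

module _ {Y : ℕ → Set} where

  InitSegOf-head-≤ : ∀ {a b s t} → InitSegOf (a ∷ s) Y → InitSegOf (b ∷ t) Y → a ≤ b
  InitSegOf-head-≤ {a} {b} (inc , _ , closed) (_ , Yb ∷ _ , _) =
    [ id , (λ b≤a → head≤∈ inc (closed b Yb (a , here refl , b≤a))) ]′ (≤-total a b)

  InitSegOf-tail : ∀ {a s} → InitSegOf (a ∷ s) Y → InitSegOf s (λ n → Y n × a < n)
  InitSegOf-tail (inc , _ ∷ Ys , closed) =
    Linked.tail inc , All.zip (Ys , head<tail inc) ,
    λ { n (Yn , a<n) (k , k∈s , n≤k) → tail-member a<n (closed n Yn (k , there k∈s , n≤k)) }
    where
    tail-member : ∀ {a n s} → a < n → n ∈ a ∷ s → n ∈ s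
    tail-member a<n (here refl) = ⊥-elim (<⇒≱ a<n ≤-refl)
    tail-member _ (there n∈s) = n∈s

InitSegOf-comparable : ∀ {Y s t} → InitSegOf s Y → InitSegOf t Y → s ≡ t ⊎ s ⊏ t ⊎ t ⊏ s
InitSegOf-comparable {s = []} {[]} _ _ = inj₁ refl
InitSegOf-comparable {s = []} {b ∷ t} _ _ = inj₂ (inj₁ (b , t , refl))
InitSegOf-comparable {s = a ∷ s} {[]} _ _ = inj₂ (inj₂ (a , s , refl))
InitSegOf-comparable {s = a ∷ s} {b ∷ t} as⊏Y bt⊏Y
  with ≤-antisym (InitSegOf-head-≤ as⊏Y bt⊏Y) (InitSegOf-head-≤ bt⊏Y as⊏Y)
... | refl = Sum.map (cong (a ∷_)) (Sum.map ∷-⊏ ∷-⊏)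
               (InitSegOf-comparable (InitSegOf-tail as⊏Y) (InitSegOf-tail bt⊏Y))

T-snoc : ∀ {B s n} → T B s → ¬ B s → Base B n → All (_< n) s → T B (s ++ [ n ])
T-snoc {s = s} (inc , s⊆base , no-prefix) ¬Bs base-n s<n =
  Increasing-snoc inc s<n , ++⁺ s⊆base (base-n ∷ []) ,
  λ u u⊏s++n Bu → [ (λ { refl → ¬Bs Bu }) , (λ u⊏s → no-prefix u u⊏s Bu) ]′ (⊏-snoc⁻ s u⊏s++n)

Ht-leaf : ∀ {B s α} → B s → Ht B s α → α ≡ ozero
Ht-leaf _ (leaf _ _) = refl
Ht-leaf Bs (node _ ¬Bs _ _) = ⊥-elim (¬Bs Bs)

record Simulation (B₁ B₂ : Family) : Set₁ where
  field
    _∼_ : List ℕ → List ℕ → Set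
    leaf-reflect : ∀ {s s'} → s ∼ s' → T B₁ s → T B₂ s' → B₂ s' → B₁ s
    child-lift : ∀ {s s'} → s ∼ s' → T B₁ s → T B₂ s' → ¬ B₂ s' → (c : Child B₁ s) →
      Σ (Child B₂ s') λ c' → (s ++ [ proj₁ c ]) ∼ (s' ++ [ proj₁ c' ])

module _ {B₁ B₂ : Family} (S : Simulation B₁ B₂) where
  open Simulation S

  Ht-≤o : ∀ {s s' α β} → s ∼ s' → Ht B₁ s α → Ht B₂ s' β → α ≤o β
  Ht-≤o _ (leaf _ _) _ = tt
  Ht-≤o s∼s' (node Ts ¬B₁s _ _) (leaf Ts' B₂s') = ⊥-elim (¬B₁s (leaf-reflect s∼s' Ts Ts' B₂s'))
  Ht-≤o s∼s' (node Ts _ _ hts) (node Ts' ¬B₂s' _ hts') c =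
    let c' , c∼c' = child-lift s∼s' Ts Ts' ¬B₂s' c
    in c' , Ht-≤o c∼c' (hts c) (hts' c')

module NontrivialFront (B : Family)
  (base-infinite : Infinite (Union B))
  (initial-segment : (X : ℕ → Set) → Infinite X → ((n : ℕ) → X n → Base B n) →
    Σ (List ℕ) λ s → B s × InitSegOf s X)
  (⊏-free : (s t : List ℕ) → B s → B t → ¬ (s ⊏ t)) where

  ¬B[] : ¬ B []
  ¬B[] B[] =
    let _ , _ , t , Bt , n∈t = base-infinite 0
    in ⊏-free [] t B[] Bt (∈-nonempty n∈t)
    where
    ∈-nonempty : ∀ {n t} → n ∈ t → [] ⊏ t
    ∈-nonempty {t = a ∷ t} _ = a , t , refl

  Base⇒Union : ∀ {n} → Base B n → Union B n
  Base⇒Union (inj₁ (_ , B[])) = ⊥-elim (¬B[] B[])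
  Base⇒Union (inj₂ u) = u

  T⇒⊑member : ∀ {s} → T B s → Σ (List ℕ) λ t → B t × (s ≡ t ⊎ s ⊏ t)
  T⇒⊑member {s} (inc , s⊆base , no-prefix) =
    let t , Bt , t⊏Y = initial-segment Y Y-infinite Y⊆base
    in t , Bt , Sum.map₂ [ id , (λ t⊏s → ⊥-elim (no-prefix t t⊏s Bt)) ]′
                         (InitSegOf-comparable s⊏Y t⊏Y)
    where
    Y : ℕ → Set
    Y n = n ∈ s ⊎ (Union B n × All (_< n) s)
    Y-infinite : Infinite Y
    Y-infinite q = let n , q≤n , s<n , Un = Infinite-above base-infinite q s in n , q≤n , inj₂ (Un , s<n)
    Y⊆base : (n : ℕ) → Y n → Base B n
    Y⊆base n (inj₁ n∈s) = All.lookup s⊆base n∈s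
    Y⊆base n (inj₂ (Un , _)) = inj₂ Un
    s⊏Y : InitSegOf s Y
    s⊏Y = inc , All.tabulate inj₁ , λ where
      n (inj₁ n∈s) _ → n∈s
      n (inj₂ (_ , s<n)) (k , k∈s , n≤k) → ⊥-elim (<⇒≱ (All.lookup s<n k∈s) n≤k)

  least-member : ∀ {n} → Base B n → Σ (List ℕ) λ t → B t × n ∈ t × All (n ≤_) t
  least-member {n} base-n with initial-segment Y Y-infinite (λ _ → inj₂ ∘ proj₁)
    where
    Y : ℕ → Set
    Y k = Union B k × n ≤ k
    Y-infinite : Infinite Y
    Y-infinite q = let k , q⊔n≤k , Uk = base-infinite (q ⊔ n) in
      k , m⊔n≤o⇒m≤o q n q⊔n≤k , Uk , m⊔n≤o⇒n≤o q n q⊔n≤k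
  ... | [] , B[] , _ = ⊥-elim (¬B[] B[])
  ... | a ∷ t , Bt , (_ , Ya ∷ Yt , closed) =
    a ∷ t , Bt , closed n (Base⇒Union base-n , ≤-refl) (a , here refl , proj₂ Ya) ,
    All.map proj₂ (Ya ∷ Yt)

  smooth-dominated-member : ∀ {s s'} → IsSmooth B → T B s → Pointwise _≤_ s s' → B s' → B s
  smooth-dominated-member smooth Ts s≤s' Bs' with T⇒⊑member Ts
  ... | t , Bt , inj₁ refl = Bt
  ... | t , Bt , inj₂ s⊏t = ⊥-elim (smooth-¬⊏ smooth Bs' Bt s≤s' s⊏t)

  module Restriction (m : ℕ) where

    X : ℕ → Set
    X = FinalSeg B m

    B↾X : Family
    B↾X = Restrict B X

    X-infinite : Infinite X
    X-infinite q = let k , q⊔m≤k , Uk = base-infinite (q ⊔ m) in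
      k , m⊔n≤o⇒m≤o q m q⊔m≤k , inj₂ Uk , m⊔n≤o⇒n≤o q m q⊔m≤k

    Base-Restrict⇒X : ∀ {n} → Base B↾X n → X n
    Base-Restrict⇒X (inj₁ (_ , (B[] , _))) = ⊥-elim (¬B[] B[])
    Base-Restrict⇒X (inj₂ (_ , (_ , t⊆X) , n∈t)) = All.lookup t⊆X n∈t

    X⇒Base-Restrict : ∀ {n} → X n → Base B↾X n
    X⇒Base-Restrict (base-n , m≤n) =
      let t , Bt , n∈t , n≤t = least-member base-n
          t⊆X = All.tabulate λ {k} k∈t → inj₂ (t , Bt , k∈t) , ≤-trans m≤n (All.lookup n≤t k∈t)
      in inj₂ (t , (Bt , t⊆X) , n∈t)

    T-Restrict⇒T : ∀ {s} → T B↾X s → T B s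
    T-Restrict⇒T (inc , s⊆base↾X , no-prefix) =
      let s⊆X = All.map Base-Restrict⇒X s⊆base↾X
      in inc , All.map proj₁ s⊆X , λ u u⊏s Bu → no-prefix u u⊏s (Bu , All-⊏ s⊆X u⊏s)

    inclusion : Simulation B↾X B
    inclusion = record
      { _∼_ = _≡_
      ; leaf-reflect = λ { refl (_ , s⊆base↾X , _) _ Bs → Bs , All.map Base-Restrict⇒X s⊆base↾X }
      ; child-lift = λ { refl _ _ _ (n , Tsn) → (n , T-Restrict⇒T Tsn) , refl }
      }

    domination : IsSmooth B → Simulation B B↾X
    domination smooth = record
      { _∼_ = Pointwise _≤_
      ; leaf-reflect = λ s≤s' Ts _ (Bs' , _) → smooth-dominated-member smooth Ts s≤s' Bs'
      ; child-lift = λ { {s' = s'} s≤s' _ Ts' ¬Bs' (n , _) →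
          let n' , n≤n' , s'<n' , Xn' = Infinite-above X-infinite n s'
          in (n' , T-snoc Ts' ¬Bs' (X⇒Base-Restrict Xn') s'<n') , Pointwise.++⁺ s≤s' (n≤n' ∷ []) }
      }

lemma2p23 : (B : List ℕ → Set) → IsBarrier B → IsSmooth B → (m : ℕ) →
    (α β : Ord) → Ht B [] α → Ht (Restrict B (FinalSeg B m)) [] β → α ≈o β
lemma2p23 B ((_ , inj₁ (_ , B[])) , _) _ _ _ _ htα htβ
  rewrite Ht-leaf B[] htα | Ht-leaf (B[] , []) htβ = tt , tt
lemma2p23 B ((_ , inj₂ (base-infinite , initial-segment , ⊏-free)) , _) smooth m _ _ htα htβ =
  Ht-≤o (domination smooth) [] htα htβ , Ht-≤o inclusion refl htβ htα
  where open NontrivialFront B base-infinite initial-segment ⊏-free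
        open Restriction m
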